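{- Let the numbers $a_{n,m}$ be as in the context. Then: (a) for all $\mu=0,1,2,\dots$, $a_{2\mu-1,\mu}=\frac{(2\mu)!}{2^\mu\mu!}=(2\mu-1)!!$; (b) for all $\mu=1,2,3,\dots$, $a_{2\mu-1,\mu-1}=\mu\cdot(2\mu-1)!!$; (c) for all $\mu=1,2,3,\dots$, $a_{2\mu,\mu-1}=\frac{\mu}{3}(2\mu+1)!!$.
   Context: The numbers $a_{n,m}$ ($n,m\in\mathbb N_0$) are defined by $a_{n,0}=1$ for all $n\ge0$, $a_{0,m}=0$ for all $m>0$, and recursively $a_{n,m}=(n-2(m-1))a_{n-1,m-1}+a_{n-1,m}$ for $n,m>0$; moreover $a_{ -1,0}=1$ by convention, and $(-1)!!=1$. -}

module Defs where

open import Data.Nat using (ℕ; zero; suc; _*_)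
open import Data.Integer using (ℤ; +_; _-_) renaming (_*_ to _*ℤ_; _+_ to _+ℤ_)

-- a n m  =  a_{n,m}  (values in ℤ, since the factor n - 2(m-1) may be negative)
-- a_{n,0} = 1, a_{0,m} = 0 (m > 0),
-- a_{n,m} = (n - 2(m-1)) a_{n-1,m-1} + a_{n-1,m}   (n, m > 0)
a : ℕ → ℕ → ℤ
a n zero = + 1
a zero (suc m) = + 0
a (suc n) (suc m) = ((+ suc n) - (+ (2 * m))) *ℤ a n m +ℤ a n (suc m)

-- aPred k m = a_{k-1,m}; for k = 0 this is the convention a_{-1,0} = 1
-- (a_{-1,m} for m > 0 is not defined by the paper and never used; set to 0).
aPred : ℕ → ℕ → ℤ
aPred zero zero = + 1
aPred zero (suc m) = + 0
aPred (suc n) m = a n m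

_!! : ℕ → ℕ
zero !! = 1
suc zero !! = 1
suc (suc n) !! = suc (suc n) * (n !!)

-- dfPred k = (k-1)!!, with the convention (-1)!! = 1
dfPred : ℕ → ℕ
dfPred zero = 1
dfPred (suc k) = k !!

{-# OPTIONS --safe #-}
module Submission where

open import Defs
open import Data.Nat using (ℕ; zero; suc; _*_; _+_; _∸_; _^_; _≤_; _<_; _≤?_; s≤s; z≤n; _!)
open import Data.Nat.Properties
  using ( +-comm; +-cancelˡ-≡; *-comm; *-assoc; *-suc; *-zeroʳ; *-identityˡ; *-identityʳ
        ; *-distribˡ-+; *-distribʳ-+; *-cancelˡ-≡; m∸n+n≡m; ≰⇒>; m<n⇒m<1+n)
open import Data.Nat.Combinatorics
  using (_C_; nCn≡1; nC1≡n; k>n⇒nCk≡0; nCk+nC[k+1]≡[n+1]C[k+1])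
open import Data.Nat.Tactic.RingSolver using (solve-∀)
open import Data.Integer using (ℤ; +_; _-_) renaming (_*_ to _*ℤ_; _+_ to _+ℤ_)
import Data.Integer.Properties as ℤ
open import Data.Product using (_×_; _,_)
open import Relation.Nullary using (yes; no)
open import Relation.Binary.PropositionalEquality
  using (_≡_; refl; sym; trans; cong; cong₂; subst; module ≡-Reasoning)

-- a_{n,m} = C(n+1, 2m) · (2m-1)!!.  Both sides satisfy the recurrence, because
-- (N - r) C(N,r) = (r+1) C(N,r+1) turns the first summand into a term that
-- Pascal's rule merges with the second.  The three identities are then the
-- values C(2μ,2μ) = 1, C(2μ,2μ-2) = μ(2μ-1) and C(2μ+1,2μ-2) = μ(2μ+1)(2μ-1)/3.

open ≡-Reasoning

[k+1]*[n+1]C[k+1]≡[n+1]*nCk : ∀ n k → suc k * (suc n C suc k) ≡ suc n * (n C k)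
[k+1]*[n+1]C[k+1]≡[n+1]*nCk n zero =
  trans (cong (1 *_) (nC1≡n (suc n))) (*-comm 1 (suc n))
[k+1]*[n+1]C[k+1]≡[n+1]*nCk zero (suc k) = begin
  suc (suc k) * (1 C suc (suc k)) ≡⟨ cong (suc (suc k) *_) (k>n⇒nCk≡0 {1} {suc (suc k)} (s≤s (s≤s z≤n))) ⟩
  suc (suc k) * 0                 ≡⟨ *-zeroʳ (suc (suc k)) ⟩
  0                               ≡⟨ cong (1 *_) (k>n⇒nCk≡0 {0} {suc k} (s≤s z≤n)) ⟨
  1 * (0 C suc k)                 ∎
[k+1]*[n+1]C[k+1]≡[n+1]*nCk (suc n) (suc k) = begin
  suc (suc k) * (suc (suc n) C suc (suc k))
    ≡⟨ cong (suc (suc k) *_) (nCk+nC[k+1]≡[n+1]C[k+1] (suc n) (suc k)) ⟨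
  suc (suc k) * (x + y)                          ≡⟨ split k x y ⟩
  suc k * x + x + suc (suc k) * y
    ≡⟨ cong₂ (λ p q → p + x + q) ([k+1]*[n+1]C[k+1]≡[n+1]*nCk n k)
                                 ([k+1]*[n+1]C[k+1]≡[n+1]*nCk n (suc k)) ⟩
  suc n * (n C k) + x + suc n * (n C suc k)      ≡⟨ merge n x (n C k) (n C suc k) ⟩
  suc n * (n C k + n C suc k) + x
    ≡⟨ cong (λ s → suc n * s + x) (nCk+nC[k+1]≡[n+1]C[k+1] n k) ⟩
  suc n * x + x                                  ≡⟨ +-suc-* n x ⟩
  suc (suc n) * x                                ∎
  where
  x = suc n C suc k
  y = suc n C suc (suc k)
  split : ∀ k x y → suc (suc k) * (x + y) ≡ suc k * x + x + suc (suc k) * y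
  split = solve-∀
  merge : ∀ n x u v → suc n * u + x + suc n * v ≡ suc n * (u + v) + x
  merge = solve-∀
  +-suc-* : ∀ n x → suc n * x + x ≡ suc (suc n) * x
  +-suc-* = solve-∀

[r+1]*[k+r]C[r+1]≡k*[k+r]Cr : ∀ k r → suc r * ((k + r) C suc r) ≡ k * ((k + r) C r)
[r+1]*[k+r]C[r+1]≡k*[k+r]Cr k r = +-cancelˡ-≡ (suc r * x) _ _ (begin
  suc r * x + suc r * y          ≡⟨ *-distribˡ-+ (suc r) x y ⟨
  suc r * (x + y)                ≡⟨ cong (suc r *_) (nCk+nC[k+1]≡[n+1]C[k+1] (k + r) r) ⟩
  suc r * (suc (k + r) C suc r)  ≡⟨ [k+1]*[n+1]C[k+1]≡[n+1]*nCk (k + r) r ⟩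
  suc (k + r) * x                ≡⟨ cong (λ n → suc n * x) (+-comm k r) ⟩
  (suc r + k) * x                ≡⟨ *-distribʳ-+ x (suc r) k ⟩
  suc r * x + k * x              ∎)
  where
  x = (k + r) C r
  y = (k + r) C suc r

[n-r]*nCr≡[r+1]*nC[r+1] : ∀ n r → (+ n - + r) *ℤ + (n C r) ≡ + (suc r * (n C suc r))
[n-r]*nCr≡[r+1]*nC[r+1] n r with r ≤? n
... | yes r≤n = begin
  (+ n - + r) *ℤ + (n C r)   ≡⟨ cong (_*ℤ + (n C r)) (trans (ℤ.[+m]-[+n]≡m⊖n n r) (ℤ.⊖-≥ r≤n)) ⟩
  + (n ∸ r) *ℤ + (n C r)     ≡⟨ ℤ.pos-* (n ∸ r) (n C r) ⟨
  + ((n ∸ r) * (n C r))      ≡⟨ cong +_ (subst (λ m → suc r * (m C suc r) ≡ (n ∸ r) * (m C r))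
                                               (m∸n+n≡m r≤n) ([r+1]*[k+r]C[r+1]≡k*[k+r]Cr (n ∸ r) r)) ⟨
  + (suc r * (n C suc r))    ∎
... | no r≰n = begin
  (+ n - + r) *ℤ + (n C r)   ≡⟨ cong (λ c → (+ n - + r) *ℤ + c) (k>n⇒nCk≡0 n<r) ⟩
  (+ n - + r) *ℤ + 0         ≡⟨ ℤ.*-zeroʳ (+ n - + r) ⟩
  + 0                        ≡⟨ cong +_ (*-zeroʳ (suc r)) ⟨
  + (suc r * 0)              ≡⟨ cong (λ c → + (suc r * c)) (k>n⇒nCk≡0 (m<n⇒m<1+n n<r)) ⟨
  + (suc r * (n C suc r))    ∎
  where n<r = ≰⇒> r≰n

[1+n]Cn≡1+n : ∀ n → suc n C n ≡ suc n
[1+n]Cn≡1+n n = begin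
  suc n C n                ≡⟨ *-identityˡ (suc n C n) ⟨
  1 * (suc n C n)          ≡⟨ [r+1]*[k+r]C[r+1]≡k*[k+r]Cr 1 n ⟨
  suc n * (suc n C suc n)  ≡⟨ cong (suc n *_) (nCn≡1 (suc n)) ⟩
  suc n * 1                ≡⟨ *-identityʳ (suc n) ⟩
  suc n                    ∎

2*[2+n]Cn≡[2+n]*[1+n] : ∀ n → 2 * ((2 + n) C n) ≡ (2 + n) * (1 + n)
2*[2+n]Cn≡[2+n]*[1+n] n = begin
  2 * ((2 + n) C n)         ≡⟨ [r+1]*[k+r]C[r+1]≡k*[k+r]Cr 2 n ⟨
  suc n * ((2 + n) C suc n) ≡⟨ cong (suc n *_) ([1+n]Cn≡1+n (suc n)) ⟩
  suc n * (2 + n)           ≡⟨ *-comm (suc n) (2 + n) ⟩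
  (2 + n) * (1 + n)         ∎

6*[3+n]Cn≡[3+n]*[2+n]*[1+n] : ∀ n → 6 * ((3 + n) C n) ≡ (3 + n) * (2 + n) * (1 + n)
6*[3+n]Cn≡[3+n]*[2+n]*[1+n] n = begin
  6 * x                       ≡⟨ regroup x ⟩
  2 * (3 * x)                 ≡⟨ cong (2 *_) ([r+1]*[k+r]C[r+1]≡k*[k+r]Cr 3 n) ⟨
  2 * (suc n * y)             ≡⟨ swap n y ⟩
  suc n * (2 * y)             ≡⟨ cong (suc n *_) (2*[2+n]Cn≡[2+n]*[1+n] (suc n)) ⟩
  suc n * ((3 + n) * (2 + n)) ≡⟨ rotate n ⟩
  (3 + n) * (2 + n) * (1 + n) ∎
  where
  x = (3 + n) C n
  y = (3 + n) C suc n
  regroup : ∀ x → 6 * x ≡ 2 * (3 * x)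
  regroup = solve-∀
  swap : ∀ n y → 2 * (suc n * y) ≡ suc n * (2 * y)
  swap = solve-∀
  rotate : ∀ n → suc n * ((3 + n) * (2 + n)) ≡ (3 + n) * (2 + n) * (1 + n)
  rotate = solve-∀

[2+2n]C[2n]≡[1+n]*[1+2n] : ∀ n → (2 + 2 * n) C (2 * n) ≡ suc n * suc (2 * n)
[2+2n]C[2n]≡[1+n]*[1+2n] n =
  *-cancelˡ-≡ _ _ 2 (trans (2*[2+n]Cn≡[2+n]*[1+n] (2 * n)) (halve n))
  where
  halve : ∀ n → (2 + 2 * n) * (1 + 2 * n) ≡ 2 * (suc n * suc (2 * n))
  halve = solve-∀

3*[3+2n]C[2n]≡[1+n]*[3+2n]*[1+2n] : ∀ n → 3 * ((3 + 2 * n) C (2 * n)) ≡ suc n * (3 + 2 * n) * suc (2 * n)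
3*[3+2n]C[2n]≡[1+n]*[3+2n]*[1+2n] n = *-cancelˡ-≡ _ _ 2 (begin
  2 * (3 * x)                              ≡⟨ regroup x ⟩
  6 * x                                    ≡⟨ 6*[3+n]Cn≡[3+n]*[2+n]*[1+n] (2 * n) ⟩
  (3 + 2 * n) * (2 + 2 * n) * (1 + 2 * n)  ≡⟨ halve n ⟩
  2 * (suc n * (3 + 2 * n) * suc (2 * n))  ∎)
  where
  x = (3 + 2 * n) C (2 * n)
  regroup : ∀ x → 2 * (3 * x) ≡ 6 * x
  regroup = solve-∀
  halve : ∀ n → (3 + 2 * n) * (2 + 2 * n) * (1 + 2 * n) ≡ 2 * (suc n * (3 + 2 * n) * suc (2 * n))
  halve = solve-∀

dfPred[2+n]≡[1+n]*dfPred[n] : ∀ n → dfPred (2 + n) ≡ suc n * dfPred n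
dfPred[2+n]≡[1+n]*dfPred[n] zero    = refl
dfPred[2+n]≡[1+n]*dfPred[n] (suc n) = refl

dfPred[2[1+n]]≡[1+2n]*dfPred[2n] : ∀ n → dfPred (2 * suc n) ≡ suc (2 * n) * dfPred (2 * n)
dfPred[2[1+n]]≡[1+2n]*dfPred[2n] n = trans (cong dfPred (*-suc 2 n)) (dfPred[2+n]≡[1+n]*dfPred[n] (2 * n))

dfPred[2n]*2^n*n!≡[2n]! : ∀ n → dfPred (2 * n) * (2 ^ n * n !) ≡ (2 * n) !
dfPred[2n]*2^n*n!≡[2n]! zero    = refl
dfPred[2n]*2^n*n!≡[2n]! (suc n) = begin
  dfPred (2 * suc n) * (2 ^ suc n * suc n !)
    ≡⟨ cong (_* (2 ^ suc n * suc n !)) (dfPred[2[1+n]]≡[1+2n]*dfPred[2n] n) ⟩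
  suc (2 * n) * dfPred (2 * n) * (2 * 2 ^ n * (suc n * n !))
    ≡⟨ regroup n (dfPred (2 * n)) (2 ^ n) (n !) ⟩
  (2 + 2 * n) * (suc (2 * n) * (dfPred (2 * n) * (2 ^ n * n !)))
    ≡⟨ cong (λ f → (2 + 2 * n) * (suc (2 * n) * f)) (dfPred[2n]*2^n*n!≡[2n]! n) ⟩
  (2 + 2 * n) !
    ≡⟨ cong _! (*-suc 2 n) ⟨
  (2 * suc n) ! ∎
  where
  regroup : ∀ n d p f → suc (2 * n) * d * (2 * p * (suc n * f)) ≡ (2 + 2 * n) * (suc (2 * n) * (d * (p * f)))
  regroup = solve-∀

C*dfPred-step : ∀ N r d →
  (+ N - + r) *ℤ + ((N C r) * d) +ℤ + ((N C (2 + r)) * (suc r * d)) ≡ + ((suc N C (2 + r)) * (suc r * d))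
C*dfPred-step N r d = begin
  (+ N - + r) *ℤ + ((N C r) * d) +ℤ + z
    ≡⟨ cong (λ t → (+ N - + r) *ℤ t +ℤ + z) (ℤ.pos-* (N C r) d) ⟩
  (+ N - + r) *ℤ (+ (N C r) *ℤ + d) +ℤ + z
    ≡⟨ cong (_+ℤ + z) (ℤ.*-assoc (+ N - + r) (+ (N C r)) (+ d)) ⟨
  (+ N - + r) *ℤ + (N C r) *ℤ + d +ℤ + z
    ≡⟨ cong (λ t → t *ℤ + d +ℤ + z) ([n-r]*nCr≡[r+1]*nC[r+1] N r) ⟩
  + (suc r * (N C suc r)) *ℤ + d +ℤ + z
    ≡⟨ cong (_+ℤ + z) (ℤ.pos-* (suc r * (N C suc r)) d) ⟨
  + (suc r * (N C suc r) * d) +ℤ + z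
    ≡⟨ ℤ.pos-+ (suc r * (N C suc r) * d) z ⟨
  + (suc r * (N C suc r) * d + z)
    ≡⟨ cong +_ (factor r d (N C suc r) (N C (2 + r))) ⟩
  + ((N C suc r + N C (2 + r)) * (suc r * d))
    ≡⟨ cong (λ c → + (c * (suc r * d))) (nCk+nC[k+1]≡[n+1]C[k+1] N (suc r)) ⟩
  + ((suc N C (2 + r)) * (suc r * d)) ∎
  where
  z = (N C (2 + r)) * (suc r * d)
  factor : ∀ r d x y → suc r * x * d + y * (suc r * d) ≡ (x + y) * (suc r * d)
  factor = solve-∀

a≡C*dfPred : ∀ n m → a n m ≡ + ((suc n C (2 * m)) * dfPred (2 * m))
a≡C*dfPred n       zero    = refl
a≡C*dfPred zero    (suc m) =
  cong (λ c → + (c * dfPred (2 * suc m))) (sym (k>n⇒nCk≡0 (subst (1 <_) (sym (*-suc 2 m)) (s≤s (s≤s z≤n)))))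
a≡C*dfPred (suc n) (suc m) = begin
  (+ suc n - + (2 * m)) *ℤ a n m +ℤ a n (suc m)
    ≡⟨ cong₂ (λ x y → (+ suc n - + (2 * m)) *ℤ x +ℤ y)
             (a≡C*dfPred n m) (trans (a≡C*dfPred n (suc m)) (cong +_ (shift (suc n)))) ⟩
  (+ suc n - + (2 * m)) *ℤ + ((suc n C (2 * m)) * d) +ℤ + ((suc n C (2 + 2 * m)) * (suc (2 * m) * d))
    ≡⟨ C*dfPred-step (suc n) (2 * m) d ⟩
  + ((suc (suc n) C (2 + 2 * m)) * (suc (2 * m) * d))
    ≡⟨ cong +_ (shift (suc (suc n))) ⟨
  + ((suc (suc n) C (2 * suc m)) * dfPred (2 * suc m)) ∎
  where
  d = dfPred (2 * m)
  shift : ∀ N → (N C (2 * suc m)) * dfPred (2 * suc m) ≡ (N C (2 + 2 * m)) * (suc (2 * m) * d)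
  shift N = cong₂ (λ k e → (N C k) * e) (*-suc 2 m) (dfPred[2[1+n]]≡[1+2n]*dfPred[2n] m)

aPred[2n,n]≡[2n-1]!! : ∀ n → aPred (2 * n) n ≡ + dfPred (2 * n)
aPred[2n,n]≡[2n-1]!! zero    = refl
aPred[2n,n]≡[2n-1]!! (suc n) = trans (a≡C*dfPred _ (suc n))
  (cong +_ (trans (cong (_* dfPred (2 * suc n)) (nCn≡1 (2 * suc n))) (*-identityˡ (dfPred (2 * suc n)))))

aPred[2n,n]*2^n*n!≡[2n]! : ∀ n → aPred (2 * n) n *ℤ + (2 ^ n * n !) ≡ + ((2 * n) !)
aPred[2n,n]*2^n*n!≡[2n]! n = begin
  aPred (2 * n) n *ℤ + (2 ^ n * n !)   ≡⟨ cong (_*ℤ + (2 ^ n * n !)) (aPred[2n,n]≡[2n-1]!! n) ⟩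
  + dfPred (2 * n) *ℤ + (2 ^ n * n !)  ≡⟨ ℤ.pos-* (dfPred (2 * n)) (2 ^ n * n !) ⟨
  + (dfPred (2 * n) * (2 ^ n * n !))   ≡⟨ cong +_ (dfPred[2n]*2^n*n!≡[2n]! n) ⟩
  + ((2 * n) !)                        ∎

a[2n+1,n]≡[n+1]*[2n+1]!! : ∀ n → a (2 * suc n ∸ 1) n ≡ + (suc n * dfPred (2 * suc n))
a[2n+1,n]≡[n+1]*[2n+1]!! n = begin
  a (2 * suc n ∸ 1) n                   ≡⟨ a≡C*dfPred (2 * suc n ∸ 1) n ⟩
  + ((2 * suc n C (2 * n)) * d)         ≡⟨ cong (λ k → + ((k C (2 * n)) * d)) (*-suc 2 n) ⟩
  + (((2 + 2 * n) C (2 * n)) * d)       ≡⟨ cong (λ c → + (c * d)) ([2+2n]C[2n]≡[1+n]*[1+2n] n) ⟩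
  + (suc n * suc (2 * n) * d)            ≡⟨ cong +_ (*-assoc (suc n) (suc (2 * n)) d) ⟩
  + (suc n * (suc (2 * n) * d))          ≡⟨ cong (λ e → + (suc n * e)) (dfPred[2[1+n]]≡[1+2n]*dfPred[2n] n) ⟨
  + (suc n * dfPred (2 * suc n))         ∎
  where d = dfPred (2 * n)

3*a[2n+2,n]≡[n+1]*[2n+3]!! : ∀ n → + 3 *ℤ a (2 * suc n) n ≡ + (suc n * ((2 * suc n + 1) !!))
3*a[2n+2,n]≡[n+1]*[2n+3]!! n = begin
  + 3 *ℤ a (2 * suc n) n                      ≡⟨ cong (+ 3 *ℤ_) (a≡C*dfPred (2 * suc n) n) ⟩
  + 3 *ℤ + ((suc (2 * suc n) C (2 * n)) * d)  ≡⟨ ℤ.pos-* 3 ((suc (2 * suc n) C (2 * n)) * d) ⟨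
  + (3 * ((suc (2 * suc n) C (2 * n)) * d))   ≡⟨ cong (λ k → + (3 * ((suc k C (2 * n)) * d))) (*-suc 2 n) ⟩
  + (3 * (((3 + 2 * n) C (2 * n)) * d))     ≡⟨ cong +_ (*-assoc 3 ((3 + 2 * n) C (2 * n)) d) ⟨
  + (3 * ((3 + 2 * n) C (2 * n)) * d)       ≡⟨ cong (λ c → + (c * d)) (3*[3+2n]C[2n]≡[1+n]*[3+2n]*[1+2n] n) ⟩
  + (suc n * (3 + 2 * n) * suc (2 * n) * d)   ≡⟨ cong +_ (regroup n d) ⟩
  + (suc n * ((3 + 2 * n) * (suc (2 * n) * d)))
    ≡⟨ cong (λ e → + (suc n * ((3 + 2 * n) * e))) (dfPred[2+n]≡[1+n]*dfPred[n] (2 * n)) ⟨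
  + (suc n * ((3 + 2 * n) !!))                ≡⟨ cong (λ k → + (suc n * (k !!))) (3+2n≡2[1+n]+1 n) ⟩
  + (suc n * ((2 * suc n + 1) !!))            ∎
  where
  d = dfPred (2 * n)
  regroup : ∀ n d → suc n * (3 + 2 * n) * suc (2 * n) * d ≡ suc n * ((3 + 2 * n) * (suc (2 * n) * d))
  regroup = solve-∀
  3+2n≡2[1+n]+1 : ∀ n → 3 + 2 * n ≡ 2 * suc n + 1
  3+2n≡2[1+n]+1 = solve-∀

proposition5p7 :
    (∀ (μ : ℕ) → (aPred (2 * μ) μ *ℤ (+ (2 ^ μ * μ !)) ≡ + ((2 * μ) !))
                 × (aPred (2 * μ) μ ≡ + dfPred (2 * μ)))
    × (∀ (μ : ℕ) → 1 ≤ μ → a (2 * μ ∸ 1) (μ ∸ 1) ≡ + (μ * dfPred (2 * μ)))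
    × (∀ (μ : ℕ) → 1 ≤ μ → (+ 3) *ℤ a (2 * μ) (μ ∸ 1) ≡ + (μ * ((2 * μ + 1) !!)))
proposition5p7 = (λ μ → aPred[2n,n]*2^n*n!≡[2n]! μ , aPred[2n,n]≡[2n-1]!! μ)
               , (λ { (suc n) _ → a[2n+1,n]≡[n+1]*[2n+1]!! n })
               , (λ { (suc n) _ → 3*a[2n+2,n]≡[n+1]*[2n+3]!! n })
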